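{- Let $m\ge2$ and let $n=n_0+n_1m+\cdots+n_sm^s$ be the base-$m$ representation of $n$. For a natural number $k$ let $f_k(t)=\frac{t^{(m-1)k}-1}{t^{m-1}-1}$. Then \[ p_m(n,t)\equiv t^{n_0}\prod_{j=1}^{s}t^{n_j}f_{n_j+1}(t)\pmod{t^{2m-1}f_m(t)}. \]
   Context: The $m$-ary partition polynomials $p_m(n,t)$ are defined by $\prod_{j=0}^{\infty}\frac{1}{1-tq^{m^j}}=\sum_{n=0}^{\infty}p_m(n,t)q^n$. Congruence is divisibility of the difference in $\mathbb{Z}[t]$. -}

module Defs where

open import Data.Nat as ℕ using (ℕ; zero; suc; _∸_; _<_)
open import Data.Integer as ℤ using (ℤ; +_)
open import Data.List using (List; []; _∷_; replicate; length)
open import Data.List.Relation.Unary.All using (All)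
open import Data.Product using (∃)
open import Data.Bool using (if_then_else_)
open import Data.Unit using (⊤)
open import Relation.Nullary using (¬_)
open import Relation.Binary.PropositionalEquality using (_≡_)

-- Polynomials in ℤ[t], represented by coefficient lists (lowest degree
-- first).  Two lists denote the same polynomial iff all coefficients
-- agree (trailing zeros are irrelevant).

Poly : Set
Poly = List ℤ

coeff : Poly → ℕ → ℤ
coeff []       _       = + 0
coeff (a ∷ _)  zero    = a
coeff (_ ∷ as) (suc i) = coeff as i

_≈ₚ_ : Poly → Poly → Set
p ≈ₚ q = ∀ i → coeff p i ≡ coeff q i

0ₚ : Poly
0ₚ = []

1ₚ : Poly
1ₚ = + 1 ∷ []

_+ₚ_ : Poly → Poly → Poly
[]       +ₚ q        = q
(a ∷ p)  +ₚ []       = a ∷ p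
(a ∷ p)  +ₚ (b ∷ q)  = (a ℤ.+ b) ∷ (p +ₚ q)

-ₚ_ : Poly → Poly
-ₚ []      = []
-ₚ (a ∷ p) = ℤ.- a ∷ -ₚ p

_-ₚ_ : Poly → Poly → Poly
p -ₚ q = p +ₚ (-ₚ q)

_·ₚ_ : ℤ → Poly → Poly
c ·ₚ []      = []
c ·ₚ (a ∷ p) = (c ℤ.* a) ∷ (c ·ₚ p)

_*ₚ_ : Poly → Poly → Poly
[]      *ₚ q = []
(a ∷ p) *ₚ q = (a ·ₚ q) +ₚ (+ 0 ∷ (p *ₚ q))

t^ : ℕ → Poly
t^ k = replicate k (+ 0) Data.List.++ (+ 1 ∷ [])

Σₚ : ℕ → (ℕ → Poly) → Poly
Σₚ zero    f = 0ₚ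
Σₚ (suc k) f = Σₚ k f +ₚ f k

Π₁ₚ : ℕ → (ℕ → Poly) → Poly
Π₁ₚ zero    f = 1ₚ
Π₁ₚ (suc k) f = Π₁ₚ k f *ₚ f (suc k)

_∣ₚ_ : Poly → Poly → Set
d ∣ₚ a = ∃ λ q → a ≈ₚ (q *ₚ d)

_≡_[modₚ_] : Poly → Poly → Poly → Set
a ≡ b [modₚ d ] = d ∣ₚ (a -ₚ b)

-- C m d n = coefficient of q^n in  Π_{j=0}^{d} 1/(1 - t q^{m^j}),
-- computed by expanding the last factor  1/(1 - t q^{m^d}) = Σ_a t^a q^{a m^d}:
--   C m 0 n       = t^n
--   C m (d+1) n   = Σ_{a ≥ 0, a m^{d+1} ≤ n} t^a · C m d (n - a m^{d+1})

C : ℕ → ℕ → ℕ → Poly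
C m zero    n = t^ n
C m (suc d) n = Σₚ (suc n) λ a →
  if a ℕ.* (m ℕ.^ suc d) ℕ.≤ᵇ n
  then t^ a *ₚ C m d (n ∸ a ℕ.* (m ℕ.^ suc d))
  else 0ₚ

-- p_m(n,t): since m ≥ 2 we have m^j > n for j > n, so only the factors
-- j = 0..n of the infinite product contribute to the coefficient of q^n.
p : ℕ → ℕ → Poly
p m n = C m n n

-- f_k(t) = (t^{(m-1)k} - 1)/(t^{m-1} - 1) = Σ_{i<k} t^{(m-1) i}
f : ℕ → ℕ → Poly
f m k = Σₚ k λ i → t^ ((m ∸ 1) ℕ.* i)

digitsValue : ℕ → List ℕ → ℕ
digitsValue m []       = 0
digitsValue m (d ∷ ds) = d ℕ.+ m ℕ.* digitsValue m ds

-- j-th entry of a list (0 outside the list)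
nth : List ℕ → ℕ → ℕ
nth []       _       = 0
nth (d ∷ _)  zero    = d
nth (_ ∷ ds) (suc i) = nth ds i

TopNonzero : List ℕ → Set
TopNonzero []           = ⊤
TopNonzero (d ∷ [])     = ¬ (d ≡ 0)
TopNonzero (_ ∷ e ∷ ds) = TopNonzero (e ∷ ds)

{-# OPTIONS --safe #-}
module Submission where

-- The generating function F(q) = ∏_{j≥0} 1/(1 - t q^{m^j}) satisfies (1 - t q) F(q) = F(q^m), that is
-- p(n+1) = t p(n) if m ∤ n+1 and p(mj) = t p(mj-1) + p(j). Consequently p(mk+r) = t^r p(mk)
-- for r < m, and a(k) = p(mk) satisfies a(k+1) = t^m a(k) + p(k+1). With h_r = t^r f_{r+1} and
-- D = t^{2m-1} f_m, the identities t^m h_r + t^{r+1} = h_{r+1} and t^m h_{m-1} = D give, by induction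
-- on (k, r), a(mk+r) ≡ h_r a(k) (mod D). Peeling off the base-m digits of n yields the theorem.

open import Defs
open import Algebra.Bundles using (CommutativeMonoid; CommutativeSemiring; CommutativeRing)
import Algebra.Consequences.Setoid as Consequences
import Algebra.Properties.CommutativeSemigroup as CommutativeSemigroupProperties
open import Data.Bool using (true; false; if_then_else_)
open import Data.Empty using (⊥-elim)
open import Data.Integer as ℤ using (+_)
import Data.Integer.Properties as ℤ
open import Data.List using (List; []; _∷_; length)
open import Data.List.Relation.Unary.All using (All; []; _∷_)
open import Data.Maybe as Maybe using (Maybe; just; nothing)
open import Data.Nat as ℕ using (ℕ; zero; suc; _∸_; _^_; _≤_; _<_; _≤ᵇ_; z≤n; s≤s; NonZero)
import Data.Nat.Properties as ℕ
open import Data.Nat.Divisibility using (_∣_; _∣0; m∣m*n; ∣m∣n⇒∣m+n; ∣m+n∣m⇒∣n; ∣⇒≤)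
open import Data.Nat.Induction using (<-rec)
open import Data.Product using (∃; _,_; proj₂)
open import Data.Sum using (inj₁; inj₂)
open import Function using (_∘_)
open import Level using (0ℓ; _⊔_)
open import Relation.Binary.Bundles using (Setoid; Preorder)
open import Relation.Binary.Structures using (IsEquivalence)
import Relation.Binary.Reasoning.Preorder as PreorderReasoning
open import Relation.Binary.PropositionalEquality using (_≡_; refl; sym; trans; cong; cong₂; subst)
open import Relation.Nullary using (¬_; yes; no)
open import Tactic.RingSolver using (solve-∀)
open import Tactic.RingSolver.Core.AlmostCommutativeRing using (AlmostCommutativeRing; fromCommutativeRing)

module Congruence {c ℓ} (R : CommutativeSemiring c ℓ) where

  open CommutativeSemiring R
  open import Relation.Binary.Reasoning.Setoid setoid

  -- Written without subtraction, so it makes sense in any commutative semiring; in ℤ[t] it is the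
  -- congruence of Defs (≡[mod]⇒≡[modₚ]).
  infix 4 _≡_[mod_]
  _≡_[mod_] : Carrier → Carrier → Carrier → Set (c ⊔ ℓ)
  x ≡ y [mod d ] = ∃ λ q → x ≈ y + q * d

  module _ {d : Carrier} where

    ≈⇒≡[mod] : ∀ {x y} → x ≈ y → x ≡ y [mod d ]
    ≈⇒≡[mod] {x} {y} x≈y = 0# , (begin
      x           ≈⟨ x≈y ⟩
      y           ≈⟨ +-identityʳ y ⟨
      y + 0#      ≈⟨ +-congˡ (zeroˡ d) ⟨
      y + 0# * d  ∎)

    ≡[mod]-trans : ∀ {x y z} → x ≡ y [mod d ] → y ≡ z [mod d ] → x ≡ z [mod d ]
    ≡[mod]-trans {x} {y} {z} (q , x≈y+qd) (r , y≈z+rd) = r + q , (begin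
      x                    ≈⟨ x≈y+qd ⟩
      y + q * d            ≈⟨ +-congʳ y≈z+rd ⟩
      z + r * d + q * d    ≈⟨ +-assoc z (r * d) (q * d) ⟩
      z + (r * d + q * d)  ≈⟨ +-congˡ (distribʳ d r q) ⟨
      z + (r + q) * d      ∎)

    +-congʳ[mod] : ∀ {x y} u → x ≡ y [mod d ] → x + u ≡ y + u [mod d ]
    +-congʳ[mod] {x} {y} u (q , x≈y+qd) = q , (begin
      x + u          ≈⟨ +-congʳ x≈y+qd ⟩
      y + q * d + u  ≈⟨ xy∙z≈xz∙y y (q * d) u ⟩
      y + u + q * d  ∎)
      where open CommutativeSemigroupProperties +-commutativeSemigroup using (xy∙z≈xz∙y)

    *-congˡ[mod] : ∀ {x y} c → x ≡ y [mod d ] → c * x ≡ c * y [mod d ]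
    *-congˡ[mod] {x} {y} c (q , x≈y+qd) = c * q , (begin
      c * x                ≈⟨ *-congˡ x≈y+qd ⟩
      c * (y + q * d)      ≈⟨ distribˡ c y (q * d) ⟩
      c * y + c * (q * d)  ≈⟨ +-congˡ (*-assoc c q d) ⟨
      c * y + (c * q) * d  ∎)

    multiple+x≡x : ∀ q x → q * d + x ≡ x [mod d ]
    multiple+x≡x q x = q , +-comm (q * d) x

  ≡[mod]-preorder : Carrier → Preorder c ℓ (c ⊔ ℓ)
  ≡[mod]-preorder d = record
    { isPreorder = record
      { isEquivalence = isEquivalence
      ; reflexive     = ≈⇒≡[mod] {d}
      ; trans         = ≡[mod]-trans {d}
      }
    }

  module ≡[mod]-Reasoning (d : Carrier) = PreorderReasoning (≡[mod]-preorder d)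

module CoefficientListRing where

  -- Wrapping _≈ₚ_ in a record lets Agda infer both polynomials from an equation.
  infix 4 _≈_
  record _≈_ (p q : Poly) : Set where
    constructor mk≈
    field coeff-≡ : p ≈ₚ q
  open _≈_ public

  ≈-isEquivalence : IsEquivalence _≈_
  ≈-isEquivalence = record
    { refl  = mk≈ λ _ → refl
    ; sym   = λ p≈q → mk≈ λ i → sym (coeff-≡ p≈q i)
    ; trans = λ p≈q q≈r → mk≈ λ i → trans (coeff-≡ p≈q i) (coeff-≡ q≈r i)
    }

  ≈-setoid : Setoid 0ℓ 0ℓ
  ≈-setoid = record { isEquivalence = ≈-isEquivalence }

  open IsEquivalence ≈-isEquivalence public
    using () renaming (refl to ≈-refl; sym to ≈-sym; trans to ≈-trans; reflexive to ≈-reflexive)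
  open Consequences ≈-setoid using (comm∧idˡ⇒id; comm∧invˡ⇒inv; comm∧distrˡ⇒distr)
  open import Relation.Binary.Reasoning.Setoid ≈-setoid

  coeff-+ : ∀ p q i → coeff (p +ₚ q) i ≡ coeff p i ℤ.+ coeff q i
  coeff-+ []      q       i       = sym (ℤ.+-identityˡ _)
  coeff-+ (a ∷ p) []      i       = sym (ℤ.+-identityʳ _)
  coeff-+ (a ∷ p) (b ∷ q) zero    = refl
  coeff-+ (a ∷ p) (b ∷ q) (suc i) = coeff-+ p q i

  coeff-· : ∀ c p i → coeff (c ·ₚ p) i ≡ c ℤ.* coeff p i
  coeff-· c []      i       = sym (ℤ.*-zeroʳ c)
  coeff-· c (a ∷ p) zero    = refl
  coeff-· c (a ∷ p) (suc i) = coeff-· c p i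

  coeff-neg : ∀ p i → coeff (-ₚ p) i ≡ ℤ.- coeff p i
  coeff-neg []      i       = refl
  coeff-neg (a ∷ p) zero    = refl
  coeff-neg (a ∷ p) (suc i) = coeff-neg p i

  ∷-cong : ∀ {a b p q} → a ≡ b → p ≈ q → a ∷ p ≈ b ∷ q
  ∷-cong a≡b p≈q = mk≈ λ { zero → a≡b ; (suc i) → coeff-≡ p≈q i }

  +-cong : ∀ {p p′ q q′} → p ≈ p′ → q ≈ q′ → p +ₚ q ≈ p′ +ₚ q′
  +-cong {p} {p′} {q} {q′} p≈p′ q≈q′ = mk≈ λ i →
    trans (coeff-+ p q i)
      (trans (cong₂ ℤ._+_ (coeff-≡ p≈p′ i) (coeff-≡ q≈q′ i)) (sym (coeff-+ p′ q′ i)))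

  +-assoc : ∀ p q r → (p +ₚ q) +ₚ r ≈ p +ₚ (q +ₚ r)
  +-assoc p q r = mk≈ λ i →
    trans (trans (coeff-+ (p +ₚ q) r i) (cong (ℤ._+ coeff r i) (coeff-+ p q i)))
      (trans (ℤ.+-assoc (coeff p i) (coeff q i) (coeff r i))
        (sym (trans (coeff-+ p (q +ₚ r) i) (cong (λ x → coeff p i ℤ.+ x) (coeff-+ q r i)))))

  +-comm : ∀ p q → p +ₚ q ≈ q +ₚ p
  +-comm p q = mk≈ λ i → trans (coeff-+ p q i) (trans (ℤ.+-comm (coeff p i) _) (sym (coeff-+ q p i)))

  +-identityˡ : ∀ p → 0ₚ +ₚ p ≈ p
  +-identityˡ p = ≈-refl

  -‿cong : ∀ {p q} → p ≈ q → -ₚ p ≈ -ₚ q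
  -‿cong {p} {q} p≈q = mk≈ λ i →
    trans (coeff-neg p i) (trans (cong ℤ.-_ (coeff-≡ p≈q i)) (sym (coeff-neg q i)))

  -‿inverseˡ : ∀ p → (-ₚ p) +ₚ p ≈ 0ₚ
  -‿inverseˡ p = mk≈ λ i →
    trans (coeff-+ (-ₚ p) p i) (trans (cong (ℤ._+ coeff p i) (coeff-neg p i)) (ℤ.+-inverseˡ (coeff p i)))

  +-commutativeMonoid : CommutativeMonoid 0ℓ 0ℓ
  +-commutativeMonoid = record
    { isCommutativeMonoid = record
      { isMonoid = record
        { isSemigroup = record
          { isMagma = record { isEquivalence = ≈-isEquivalence ; ∙-cong = +-cong }
          ; assoc   = +-assoc
          }
        ; identity = comm∧idˡ⇒id +-comm +-identityˡ
        }
      ; comm = +-comm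
      }
    }

  open CommutativeMonoid +-commutativeMonoid public using () renaming (identityʳ to +-identityʳ)
  open CommutativeSemigroupProperties (CommutativeMonoid.commutativeSemigroup +-commutativeMonoid)
    using (interchange; x∙yz≈y∙xz)

  ·-cong : ∀ c {p q} → p ≈ q → c ·ₚ p ≈ c ·ₚ q
  ·-cong c {p} {q} p≈q = mk≈ λ i →
    trans (coeff-· c p i) (trans (cong (c ℤ.*_) (coeff-≡ p≈q i)) (sym (coeff-· c q i)))

  ·-distrib-+ : ∀ c p q → c ·ₚ (p +ₚ q) ≈ (c ·ₚ p) +ₚ (c ·ₚ q)
  ·-distrib-+ c p q = mk≈ λ i →
    trans (trans (coeff-· c (p +ₚ q) i) (cong (c ℤ.*_) (coeff-+ p q i)))
      (trans (ℤ.*-distribˡ-+ c (coeff p i) (coeff q i))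
        (sym (trans (coeff-+ (c ·ₚ p) (c ·ₚ q) i) (cong₂ ℤ._+_ (coeff-· c p i) (coeff-· c q i)))))

  ·-assoc : ∀ a b p → (a ℤ.* b) ·ₚ p ≈ a ·ₚ (b ·ₚ p)
  ·-assoc a b p = mk≈ λ i →
    trans (coeff-· (a ℤ.* b) p i)
      (trans (ℤ.*-assoc a b (coeff p i)) (sym (trans (coeff-· a (b ·ₚ p) i) (cong (a ℤ.*_) (coeff-· b p i)))))

  0·p≈0 : ∀ p → (+ 0) ·ₚ p ≈ 0ₚ
  0·p≈0 p = mk≈ λ i → trans (coeff-· (+ 0) p i) (ℤ.*-zeroˡ (coeff p i))

  1·p≈p : ∀ p → (+ 1) ·ₚ p ≈ p
  1·p≈p p = mk≈ λ i → trans (coeff-· (+ 1) p i) (ℤ.*-identityˡ (coeff p i))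

  0∷-*ˡ : ∀ p q → ((+ 0) ∷ p) *ₚ q ≈ (+ 0) ∷ (p *ₚ q)
  0∷-*ˡ p q = +-cong (0·p≈0 q) ≈-refl

  *-zeroʳ : ∀ p → p *ₚ 0ₚ ≈ 0ₚ
  *-zeroʳ []      = ≈-refl
  *-zeroʳ (a ∷ p) = mk≈ λ { zero → refl ; (suc i) → coeff-≡ (*-zeroʳ p) i }

  *-∷ʳ : ∀ p a q → p *ₚ (a ∷ q) ≈ (a ·ₚ p) +ₚ ((+ 0) ∷ (p *ₚ q))
  *-∷ʳ []      a q = mk≈ λ { zero → refl ; (suc i) → refl }
  *-∷ʳ (b ∷ p) a q = ∷-cong (cong (ℤ._+ + 0) (ℤ.*-comm b a)) (begin
    (b ·ₚ q) +ₚ (p *ₚ (a ∷ q))                   ≈⟨ +-cong ≈-refl (*-∷ʳ p a q) ⟩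
    (b ·ₚ q) +ₚ ((a ·ₚ p) +ₚ ((+ 0) ∷ (p *ₚ q)))  ≈⟨ x∙yz≈y∙xz (b ·ₚ q) (a ·ₚ p) _ ⟩
    (a ·ₚ p) +ₚ ((b ·ₚ q) +ₚ ((+ 0) ∷ (p *ₚ q)))  ∎)

  *-comm : ∀ p q → p *ₚ q ≈ q *ₚ p
  *-comm []      q = ≈-sym (*-zeroʳ q)
  *-comm (a ∷ p) q = ≈-trans (+-cong ≈-refl (∷-cong refl (*-comm p q))) (≈-sym (*-∷ʳ q a p))

  *-congˡ : ∀ p {q q′} → q ≈ q′ → p *ₚ q ≈ p *ₚ q′
  *-congˡ []      q≈q′ = ≈-refl
  *-congˡ (a ∷ p) q≈q′ = +-cong (·-cong a q≈q′) (∷-cong refl (*-congˡ p q≈q′))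

  *-cong : ∀ {p p′ q q′} → p ≈ p′ → q ≈ q′ → p *ₚ q ≈ p′ *ₚ q′
  *-cong {p} {p′} {q} {q′} p≈p′ q≈q′ = begin
    p *ₚ q    ≈⟨ *-congˡ p q≈q′ ⟩
    p *ₚ q′   ≈⟨ *-comm p q′ ⟩
    q′ *ₚ p   ≈⟨ *-congˡ q′ p≈p′ ⟩
    q′ *ₚ p′  ≈⟨ *-comm q′ p′ ⟩
    p′ *ₚ q′  ∎

  *-distribˡ-+ : ∀ p q r → p *ₚ (q +ₚ r) ≈ (p *ₚ q) +ₚ (p *ₚ r)
  *-distribˡ-+ []      q r = ≈-refl
  *-distribˡ-+ (a ∷ p) q r = begin
    (a ·ₚ (q +ₚ r)) +ₚ ((+ 0) ∷ (p *ₚ (q +ₚ r)))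
      ≈⟨ +-cong (·-distrib-+ a q r) (∷-cong refl (*-distribˡ-+ p q r)) ⟩
    ((a ·ₚ q) +ₚ (a ·ₚ r)) +ₚ (((+ 0) ∷ (p *ₚ q)) +ₚ ((+ 0) ∷ (p *ₚ r)))
      ≈⟨ interchange (a ·ₚ q) (a ·ₚ r) _ _ ⟩
    ((a ·ₚ q) +ₚ ((+ 0) ∷ (p *ₚ q))) +ₚ ((a ·ₚ r) +ₚ ((+ 0) ∷ (p *ₚ r)))
      ∎

  ·-*-assoc : ∀ a p q → (a ·ₚ p) *ₚ q ≈ a ·ₚ (p *ₚ q)
  ·-*-assoc a []      q = ≈-refl
  ·-*-assoc a (b ∷ p) q = begin
    ((a ℤ.* b) ·ₚ q) +ₚ ((+ 0) ∷ ((a ·ₚ p) *ₚ q))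
      ≈⟨ +-cong (·-assoc a b q) (∷-cong (sym (ℤ.*-zeroʳ a)) (·-*-assoc a p q)) ⟩
    (a ·ₚ (b ·ₚ q)) +ₚ (a ·ₚ ((+ 0) ∷ (p *ₚ q)))
      ≈⟨ ·-distrib-+ a (b ·ₚ q) _ ⟨
    a ·ₚ ((b ·ₚ q) +ₚ ((+ 0) ∷ (p *ₚ q)))
      ∎

  *-distribʳ-+ : ∀ p q r → (q +ₚ r) *ₚ p ≈ (q *ₚ p) +ₚ (r *ₚ p)
  *-distribʳ-+ = proj₂ (comm∧distrˡ⇒distr +-cong *-comm *-distribˡ-+)

  *-assoc : ∀ p q r → (p *ₚ q) *ₚ r ≈ p *ₚ (q *ₚ r)
  *-assoc []      q r = ≈-refl
  *-assoc (a ∷ p) q r = begin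
    ((a ·ₚ q) +ₚ ((+ 0) ∷ (p *ₚ q))) *ₚ r         ≈⟨ *-distribʳ-+ r (a ·ₚ q) _ ⟩
    ((a ·ₚ q) *ₚ r) +ₚ (((+ 0) ∷ (p *ₚ q)) *ₚ r)  ≈⟨ +-cong (·-*-assoc a q r) (0∷-*ˡ (p *ₚ q) r) ⟩
    (a ·ₚ (q *ₚ r)) +ₚ ((+ 0) ∷ ((p *ₚ q) *ₚ r))  ≈⟨ +-cong ≈-refl (∷-cong refl (*-assoc p q r)) ⟩
    (a ·ₚ (q *ₚ r)) +ₚ ((+ 0) ∷ (p *ₚ (q *ₚ r)))  ∎

  *-identityˡ : ∀ p → 1ₚ *ₚ p ≈ p
  *-identityˡ p = ≈-trans (+-cong (1·p≈p p) (mk≈ λ { zero → refl ; (suc i) → refl })) (+-identityʳ p)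

  ℤ[t] : CommutativeRing 0ℓ 0ℓ
  ℤ[t] = record
    { _+_ = _+ₚ_ ; _*_ = _*ₚ_ ; -_ = -ₚ_ ; 0# = 0ₚ ; 1# = 1ₚ
    ; isCommutativeRing = record
      { isRing = record
        { +-isAbelianGroup = record
          { isGroup = record
            { isMonoid = CommutativeMonoid.isMonoid +-commutativeMonoid
            ; inverse  = comm∧invˡ⇒inv +-comm -‿inverseˡ
            ; ⁻¹-cong  = -‿cong
            }
          ; comm = +-comm
          }
        ; *-cong     = *-cong
        ; *-assoc    = *-assoc
        ; *-identity = comm∧idˡ⇒id *-comm *-identityˡ
        ; distrib    = comm∧distrˡ⇒distr +-cong *-comm *-distribˡ-+
        }
      ; *-comm = *-comm
      }
    }

open CoefficientListRing using (_≈_; mk≈; coeff-≡; ∷-cong; 0∷-*ˡ; ℤ[t])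

module Polynomial where

  open CommutativeRing ℤ[t] public
    using ( commutativeSemiring; setoid; +-cong; +-assoc; +-identityˡ; +-identityʳ
          ; -‿cong; -‿inverseʳ; *-cong; *-assoc; *-comm; *-identityˡ; zeroʳ; distribˡ )
    renaming (refl to ≈-refl; sym to ≈-sym; trans to ≈-trans; reflexive to ≈-reflexive)
  open Congruence commutativeSemiring public
  open import Relation.Binary.Reasoning.Setoid setoid

  -- Infix versions of the operations of Defs, which have no fixity; the ring solver recognises them.
  infixl 6 _+_ _-_
  infixl 7 _*_
  _+_ _-_ _*_ : Poly → Poly → Poly
  _+_ = _+ₚ_
  _-_ = _-ₚ_
  _*_ = _*ₚ_

  isZero : ∀ p → Maybe (0ₚ ≈ p)
  isZero []          = just ≈-refl
  isZero ((+ 0) ∷ p) = Maybe.map (λ 0≈p → mk≈ λ { zero → refl ; (suc i) → coeff-≡ 0≈p i }) (isZero p)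
  isZero _           = nothing

  -- The zero test lets the solver cancel terms such as x - x.
  ℤ[t]-ring : AlmostCommutativeRing 0ℓ 0ℓ
  ℤ[t]-ring = fromCommutativeRing ℤ[t] isZero

  -- Poly's operations are defined functions, so Agda cannot infer p from p + q: it is explicit.
  +-congˡ : ∀ p {q r} → q ≈ r → p + q ≈ p + r
  +-congˡ p = +-cong (≈-refl {p})

  +-congʳ : ∀ p {q r} → q ≈ r → q + p ≈ r + p
  +-congʳ p q≈r = +-cong q≈r (≈-refl {p})

  *-congˡ : ∀ p {q r} → q ≈ r → p * q ≈ p * r
  *-congˡ p = *-cong (≈-refl {p})

  *-congʳ : ∀ p {q r} → q ≈ r → q * p ≈ r * p
  *-congʳ p q≈r = *-cong q≈r (≈-refl {p})

  x≈y+[x-y] : ∀ x y → x ≈ y + (x - y)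
  x≈y+[x-y] = solve-∀ ℤ[t]-ring

  ≡[mod]⇒≡[modₚ] : ∀ {x y d} → x ≡ y [mod d ] → x ≡ y [modₚ d ]
  ≡[mod]⇒≡[modₚ] {x} {y} {d} (q , x≈y+qd) = q , coeff-≡ (begin
    x - y            ≈⟨ +-congʳ (-ₚ y) x≈y+qd ⟩
    y + q * d - y    ≈⟨ cancel y (q * d) ⟩
    q * d            ∎)
    where
    cancel : ∀ y z → y + z - y ≈ z
    cancel = solve-∀ ℤ[t]-ring

  t : Poly
  t = t^ 1

  t*p≈0∷p : ∀ p → t * p ≈ (+ 0) ∷ p
  t*p≈0∷p p = ≈-trans (0∷-*ˡ 1ₚ p) (∷-cong refl (*-identityˡ p))

  t^-suc : ∀ k → t^ (suc k) ≈ t * t^ k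
  t^-suc k = ≈-sym (t*p≈0∷p (t^ k))

  t^-+ : ∀ a b → t^ (a ℕ.+ b) ≈ t^ a * t^ b
  t^-+ zero    b = ≈-sym (*-identityˡ (t^ b))
  t^-+ (suc a) b = ≈-trans (∷-cong refl (t^-+ a b)) (≈-sym (0∷-*ˡ (t^ a) (t^ b)))

  Σₚ-cong : ∀ k {f g} → (∀ a → a < k → f a ≈ g a) → Σₚ k f ≈ Σₚ k g
  Σₚ-cong zero    f≈g = ≈-refl
  Σₚ-cong (suc k) f≈g = +-cong (Σₚ-cong k λ a a<k → f≈g a (ℕ.m<n⇒m<1+n a<k)) (f≈g k ℕ.≤-refl)

  Σₚ-head : ∀ k f → Σₚ (suc k) f ≈ f 0 + Σₚ k (f ∘ suc)
  Σₚ-head zero    f = ≈-sym (+-identityʳ (f 0))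
  Σₚ-head (suc k) f = ≈-trans (+-congʳ (f (suc k)) (Σₚ-head k f)) (+-assoc (f 0) _ _)

  *-distribˡ-Σₚ : ∀ k c f → c * Σₚ k f ≈ Σₚ k (λ a → c * f a)
  *-distribˡ-Σₚ zero    c f = zeroʳ c
  *-distribˡ-Σₚ (suc k) c f = ≈-trans (distribˡ c (Σₚ k f) (f k)) (+-congʳ (c * f k) (*-distribˡ-Σₚ k c f))

  Σₚ-trailing-zeros : ∀ {k l f} → k ≤ l → (∀ a → k ≤ a → f a ≈ 0ₚ) → Σₚ l f ≈ Σₚ k f
  Σₚ-trailing-zeros {l = zero}  z≤n  _     = ≈-refl
  Σₚ-trailing-zeros {l = suc l} k≤1+l zeros with ℕ.m≤n⇒m<n∨m≡n k≤1+l
  ... | inj₂ refl       = ≈-refl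
  ... | inj₁ (s≤s k≤l) = ≈-trans (+-cong (Σₚ-trailing-zeros k≤l zeros) (zeros l k≤l)) (+-identityʳ _)

  Π₁ₚ-cong : ∀ k {f g} → (∀ j → f (suc j) ≈ g (suc j)) → Π₁ₚ k f ≈ Π₁ₚ k g
  Π₁ₚ-cong zero    f≈g = ≈-refl
  Π₁ₚ-cong (suc k) f≈g = *-cong (Π₁ₚ-cong k f≈g) (f≈g k)

  Π₁ₚ-head : ∀ k f → Π₁ₚ (suc k) f ≈ f 1 * Π₁ₚ k (f ∘ suc)
  Π₁ₚ-head zero    f = *-comm 1ₚ (f 1)
  Π₁ₚ-head (suc k) f = ≈-trans (*-congʳ (f (suc (suc k))) (Π₁ₚ-head k f)) (*-assoc (f 1) _ _)

  Π-digits : List ℕ → (ℕ → Poly) → Poly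
  Π-digits ds g = Π₁ₚ (length ds) (λ j → g (nth ds (j ∸ 1)))

  Π-digits-∷ : ∀ d ds g → Π-digits (d ∷ ds) g ≈ g d * Π-digits ds g
  Π-digits-∷ d ds g = begin
    Π-digits (d ∷ ds) g                                 ≈⟨ Π₁ₚ-head (length ds) _ ⟩
    g d * Π₁ₚ (length ds) (λ j → g (nth (d ∷ ds) j))
      ≈⟨ *-congˡ (g d) (Π₁ₚ-cong (length ds) λ j → ≈-refl {g (nth ds j)}) ⟩
    g d * Π-digits ds g                                 ∎

if-≤ᵇ-yes : ∀ {A : Set} {x y : A} {a n} → a ≤ n → (if a ≤ᵇ n then x else y) ≡ x
if-≤ᵇ-yes {a = a} {n} a≤n with a ≤ᵇ n | ℕ.≤⇒≤ᵇ a≤n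
... | true | _ = refl

if-≤ᵇ-no : ∀ {A : Set} {x y : A} {a n} → n < a → (if a ≤ᵇ n then x else y) ≡ y
if-≤ᵇ-no {a = a} {n} n<a with a ≤ᵇ n | ℕ.≤ᵇ⇒≤ a n
... | false | _   = refl
... | true  | a≤n = ⊥-elim (ℕ.<⇒≱ n<a (a≤n _))

module PartialProducts (m : ℕ) .{{_ : NonZero m}} where

  open Polynomial
  open import Relation.Binary.Reasoning.Setoid setoid

  0<m^n : ∀ n → 0 < m ^ n
  0<m^n = ℕ.m^n>0 m

  -- By definition, C m (suc d) n ≡ Σₚ (suc n) (summand d n).
  summand : ℕ → ℕ → ℕ → Poly
  summand d n a = if a ℕ.* m ^ suc d ≤ᵇ n then t^ a * C m d (n ∸ a ℕ.* m ^ suc d) else 0ₚ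

  summand-shift : ∀ d k a → summand d (m ^ suc d ℕ.+ k) (suc a) ≈ t * summand d k a
  summand-shift d k a with a ℕ.* m ^ suc d ℕ.≤? k
  ... | yes aM≤k = begin
    summand d (M ℕ.+ k) (suc a)                  ≡⟨ if-≤ᵇ-yes (ℕ.+-monoʳ-≤ M aM≤k) ⟩
    t^ (suc a) * C m d ((M ℕ.+ k) ∸ (M ℕ.+ aM))  ≡⟨ cong (λ i → t^ (suc a) * C m d i) (ℕ.[m+n]∸[m+o]≡n∸o M k aM) ⟩
    t^ (suc a) * C m d (k ∸ aM)                  ≈⟨ *-congʳ (C m d (k ∸ aM)) (t^-suc a) ⟩
    t * t^ a * C m d (k ∸ aM)                    ≈⟨ *-assoc t (t^ a) (C m d (k ∸ aM)) ⟩
    t * (t^ a * C m d (k ∸ aM))                  ≡⟨ cong (t *_) (if-≤ᵇ-yes aM≤k) ⟨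
    t * summand d k a                            ∎
    where
    M = m ^ suc d
    aM = a ℕ.* M
  ... | no aM≰k = begin
    summand d (m ^ suc d ℕ.+ k) (suc a)  ≡⟨ if-≤ᵇ-no (ℕ.+-monoʳ-< (m ^ suc d) (ℕ.≰⇒> aM≰k)) ⟩
    0ₚ                                   ≈⟨ zeroʳ t ⟨
    t * 0ₚ                               ≡⟨ cong (t *_) (if-≤ᵇ-no (ℕ.≰⇒> aM≰k)) ⟨
    t * summand d k a                    ∎

  summand-beyond : ∀ d {n a} → n < a → summand d n a ≈ 0ₚ
  summand-beyond d {n} {a} n<a =
    ≈-reflexive (if-≤ᵇ-no (ℕ.<-≤-trans n<a (ℕ.m≤m*n a (m ^ suc d) {{ℕ.m^n≢0 m (suc d)}})))

  C-suc-< : ∀ d {n} → n < m ^ suc d → C m (suc d) n ≈ C m d n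
  C-suc-< d {n} n<M = begin
    C m (suc d) n
      ≈⟨ Σₚ-head n (summand d n) ⟩
    1ₚ * C m d n + Σₚ n (summand d n ∘ suc)
      ≈⟨ +-cong (*-identityˡ (C m d n)) (Σₚ-trailing-zeros {l = n} z≤n beyond) ⟩
    C m d n + 0ₚ
      ≈⟨ +-identityʳ (C m d n) ⟩
    C m d n
      ∎
    where
    beyond : ∀ a → 0 ≤ a → summand d n (suc a) ≈ 0ₚ
    beyond a _ = ≈-reflexive (if-≤ᵇ-no (ℕ.<-≤-trans n<M (ℕ.m≤m+n (m ^ suc d) (a ℕ.* m ^ suc d))))

  C-suc-+ : ∀ d {n k} → m ^ suc d ℕ.+ k ≡ n → C m (suc d) n ≈ C m d n + t * C m (suc d) k
  C-suc-+ d {n} {k} refl = begin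
    C m (suc d) n
      ≈⟨ Σₚ-head n (summand d n) ⟩
    1ₚ * C m d n + Σₚ n (summand d n ∘ suc)
      ≈⟨ +-cong (*-identityˡ (C m d n)) (Σₚ-cong n λ a _ → summand-shift d k a) ⟩
    C m d n + Σₚ n (λ a → t * summand d k a)
      ≈⟨ +-congˡ (C m d n) (*-distribˡ-Σₚ n t (summand d k)) ⟨
    C m d n + t * Σₚ n (summand d k)
      ≈⟨ +-congˡ (C m d n) (*-congˡ t (Σₚ-trailing-zeros {l = n} k<n λ _ → summand-beyond d)) ⟩
    C m d n + t * C m (suc d) k
      ∎
    where
    k<n : k < n
    k<n = ℕ.+-monoˡ-≤ k (0<m^n (suc d))

  -- C< d n is the coefficient of qⁿ in ∏_{j<d} 1/(1 - t q^{m^j}); C m d is the product over j ≤ d.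
  C< : ℕ → ℕ → Poly
  C< zero    zero    = 1ₚ
  C< zero    (suc n) = 0ₚ
  C< (suc d) n       = C m d n

  C-below : ∀ d {n} → n < m ^ d → C m d n ≈ C< d n
  C-below zero    {zero}  _           = ≈-refl
  C-below zero    {suc n} (s≤s ())
  C-below (suc d)         n<M         = C-suc-< d n<M

  C-above : ∀ d {n k} → m ^ d ℕ.+ k ≡ n → C m d n ≈ C< d n + t * C m d k
  C-above zero    {k = k} refl = ≈-trans (t^-suc k) (≈-sym (+-identityˡ (t * t^ k)))
  C-above (suc d) M+k≡n        = C-suc-+ d M+k≡n

  -- Δ d n is the coefficient of qⁿ in (1 - t q) ∏_{j≤d} 1/(1 - t q^{m^j}).
  Δ : ℕ → ℕ → Poly
  Δ d zero    = C m d 0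
  Δ d (suc n) = C m d (suc n) - t * C m d n

  C-suc : ∀ d n → C m d (suc n) ≈ t * C m d n + Δ d (suc n)
  C-suc d n = x≈y+[x-y] (C m d (suc n)) (t * C m d n)

  Δ-zero-pos : ∀ n → 0 < n → Δ 0 n ≈ 0ₚ
  Δ-zero-pos zero    ()
  Δ-zero-pos (suc n) _ = ≈-trans (+-congʳ (-ₚ (t * t^ n)) (t^-suc n)) (-‿inverseʳ (t * t^ n))

  Δ-suc-< : ∀ d {n} → n < m ^ suc d → Δ (suc d) n ≈ Δ d n
  Δ-suc-< d {zero}  0<M = C-suc-< d 0<M
  Δ-suc-< d {suc n} n<M = +-cong (C-suc-< d n<M) (-‿cong (*-congˡ t (C-suc-< d (ℕ.<-trans (ℕ.n<1+n n) n<M))))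

  Δ-suc-+ : ∀ d {n k} → m ^ suc d ℕ.+ k ≡ n → Δ (suc d) n ≈ Δ d n + t * Δ (suc d) k
  Δ-suc-+ d {zero} {k} M+k≡0 =
    ⊥-elim (ℕ.<⇒≱ (0<m^n (suc d)) (subst (m ^ suc d ≤_) M+k≡0 (ℕ.m≤m+n (m ^ suc d) k)))
  Δ-suc-+ d {suc n} {zero} M+0≡1+n = begin
    C m (suc d) (suc n) - t * C m (suc d) n
      ≈⟨ +-cong (C-suc-+ d M+0≡1+n) (-‿cong (*-congˡ t (C-suc-< d n<M))) ⟩
    (C m d (suc n) + t * C m (suc d) 0) - t * C m d n
      ≈⟨ regroup (C m d (suc n)) (C m d n) (C m (suc d) 0) ⟩
    (C m d (suc n) - t * C m d n) + t * C m (suc d) 0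
      ∎
    where
    n<M : n < m ^ suc d
    n<M = ℕ.≤-reflexive (trans (sym M+0≡1+n) (ℕ.+-identityʳ (m ^ suc d)))
    regroup : ∀ a b c → (a + t * c) - t * b ≈ (a - t * b) + t * c
    regroup = solve-∀ ℤ[t]-ring
  Δ-suc-+ d {suc n} {suc k} M+1+k≡1+n = begin
    C m (suc d) (suc n) - t * C m (suc d) n
      ≈⟨ +-cong (C-suc-+ d M+1+k≡1+n) (-‿cong (*-congˡ t (C-suc-+ d M+k≡n))) ⟩
    (C m d (suc n) + t * C m (suc d) (suc k)) - t * (C m d n + t * C m (suc d) k)
      ≈⟨ regroup (C m d (suc n)) (C m d n) (C m (suc d) (suc k)) (C m (suc d) k) ⟩
    (C m d (suc n) - t * C m d n) + t * (C m (suc d) (suc k) - t * C m (suc d) k)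
      ∎
    where
    M+k≡n : m ^ suc d ℕ.+ k ≡ n
    M+k≡n = ℕ.suc-injective (trans (sym (ℕ.+-suc (m ^ suc d) k)) M+1+k≡1+n)
    regroup : ∀ a b c e → (a + t * c) - t * (b + t * e) ≈ (a - t * b) + t * (c - t * e)
    regroup = solve-∀ ℤ[t]-ring

  Δ-nondivisible : ∀ d n → ¬ m ∣ n → Δ d n ≈ 0ₚ
  Δ-nondivisible zero    zero    m∤0 = ⊥-elim (m∤0 (m ∣0))
  Δ-nondivisible zero    (suc n) _   = Δ-zero-pos (suc n) (s≤s z≤n)
  Δ-nondivisible (suc d) = <-rec (λ n → ¬ m ∣ n → Δ (suc d) n ≈ 0ₚ) step
    where
    step : ∀ n → (∀ {k} → k < n → ¬ m ∣ k → Δ (suc d) k ≈ 0ₚ) → ¬ m ∣ n → Δ (suc d) n ≈ 0ₚ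
    step n rec m∤n with n ℕ.<? m ^ suc d
    ... | yes n<M = ≈-trans (Δ-suc-< d n<M) (Δ-nondivisible d n m∤n)
    ... | no  n≮M = begin
      Δ (suc d) n                ≈⟨ Δ-suc-+ d M+k≡n ⟩
      Δ d n + t * Δ (suc d) k    ≈⟨ +-cong (Δ-nondivisible d n m∤n) (*-congˡ t (rec k<n m∤k)) ⟩
      0ₚ + t * 0ₚ                ≈⟨ ≈-trans (+-identityˡ (t * 0ₚ)) (zeroʳ t) ⟩
      0ₚ                         ∎
      where
      k = n ∸ m ^ suc d
      M+k≡n : m ^ suc d ℕ.+ k ≡ n
      M+k≡n = ℕ.m+[n∸m]≡n (ℕ.≮⇒≥ n≮M)
      k<n : k < n
      k<n = ℕ.∸-monoʳ-< (0<m^n (suc d)) (ℕ.≮⇒≥ n≮M)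
      m∤k : ¬ m ∣ k
      m∤k m∣k = m∤n (subst (m ∣_) M+k≡n (∣m∣n⇒∣m+n (m∣m*n (m ^ d)) m∣k))

  Δ-multiple : ∀ d j → Δ d (m ℕ.* j) ≈ C< d j
  Δ-multiple zero    zero    = ≈-reflexive (cong (Δ 0) (ℕ.*-zeroʳ m))
  Δ-multiple zero    (suc j) = Δ-zero-pos (m ℕ.* suc j) (ℕ.>-nonZero⁻¹ (m ℕ.* suc j) {{ℕ.m*n≢0 m (suc j)}})
  Δ-multiple (suc d) = <-rec (λ j → Δ (suc d) (m ℕ.* j) ≈ C m d j) step
    where
    step : ∀ j → (∀ {i} → i < j → Δ (suc d) (m ℕ.* i) ≈ C m d i) → Δ (suc d) (m ℕ.* j) ≈ C m d j
    step j rec with j ℕ.<? m ^ d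
    ... | yes j<m^d = begin
      Δ (suc d) (m ℕ.* j)  ≈⟨ Δ-suc-< d (ℕ.*-monoʳ-< m j<m^d) ⟩
      Δ d (m ℕ.* j)        ≈⟨ Δ-multiple d j ⟩
      C< d j               ≈⟨ C-below d j<m^d ⟨
      C m d j              ∎
    ... | no  j≮m^d = begin
      Δ (suc d) (m ℕ.* j)                      ≈⟨ Δ-suc-+ d M+mi≡mj ⟩
      Δ d (m ℕ.* j) + t * Δ (suc d) (m ℕ.* i)  ≈⟨ +-cong (Δ-multiple d j) (*-congˡ t (rec i<j)) ⟩
      C< d j + t * C m d i                     ≈⟨ C-above d m^d+i≡j ⟨
      C m d j                                  ∎
      where
      i = j ∸ m ^ d
      m^d+i≡j : m ^ d ℕ.+ i ≡ j
      m^d+i≡j = ℕ.m+[n∸m]≡n (ℕ.≮⇒≥ j≮m^d)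
      i<j : i < j
      i<j = ℕ.∸-monoʳ-< (0<m^n d) (ℕ.≮⇒≥ j≮m^d)
      M+mi≡mj : m ^ suc d ℕ.+ m ℕ.* i ≡ m ℕ.* j
      M+mi≡mj = trans (sym (ℕ.*-distribˡ-+ m (m ^ d) i)) (cong (m ℕ.*_) m^d+i≡j)

module Digits (m : ℕ) (2≤m : 2 ≤ m) where

  0<m : 0 < m
  0<m = ℕ.≤-trans (s≤s z≤n) 2≤m

  private instance
    m-nonZero : NonZero m
    m-nonZero = ℕ.>-nonZero 0<m

  open Polynomial
  open PartialProducts m

  D : Poly
  D = t^ (2 ℕ.* m ∸ 1) * f m m

  open ≡[mod]-Reasoning D

  m∸1<m : m ∸ 1 < m
  m∸1<m = ℕ.≤-reflexive (ℕ.suc-pred m)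

  x<m*x : ∀ x .{{_ : NonZero x}} → x < m ℕ.* x
  x<m*x x = subst (x <_) (ℕ.*-comm x m) (ℕ.m<m*n x m 2≤m)

  n<m^n : ∀ n → n < m ^ n
  n<m^n zero    = s≤s z≤n
  n<m^n (suc n) = ℕ.≤-<-trans (n<m^n n) (x<m*x (m ^ n) {{ℕ.m^n≢0 m n}})

  1+n≡m*j⇒j≤n : ∀ {n} j → suc n ≡ m ℕ.* j → j ≤ n
  1+n≡m*j⇒j≤n zero    1+n≡m*0     = ⊥-elim (ℕ.1+n≢0 (trans 1+n≡m*0 (ℕ.*-zeroʳ m)))
  1+n≡m*j⇒j≤n (suc j) 1+n≡m[1+j] = ℕ.≤-pred (subst (suc j <_) (sym 1+n≡m[1+j]) (x<m*x (suc j)))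

  m*suc≡suc[m*+m∸1] : ∀ j → m ℕ.* suc j ≡ suc (m ℕ.* j ℕ.+ (m ∸ 1))
  m*suc≡suc[m*+m∸1] j = trans (ℕ.*-suc m j) (trans (ℕ.+-comm m (m ℕ.* j))
    (trans (cong (m ℕ.* j ℕ.+_) (sym (ℕ.suc-pred m))) (ℕ.+-suc (m ℕ.* j) (m ∸ 1))))

  C-stable : ∀ {j d} → j ≤ d → C m d j ≈ p m j
  C-stable j≤d with ℕ.m≤n⇒m<n∨m≡n j≤d
  ... | inj₂ refl                = ≈-refl
  ... | inj₁ (s≤s {n = d′} j≤d′) = ≈-trans (C-suc-< d′ (ℕ.<-trans (s≤s j≤d′) (n<m^n (suc d′)))) (C-stable j≤d′)

  p-nondivisible : ∀ {n} → ¬ m ∣ suc n → p m (suc n) ≈ t * p m n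
  p-nondivisible {n} m∤1+n = begin-equality
    C m (suc n) (suc n)
      ≈⟨ C-suc (suc n) n ⟩
    t * C m (suc n) n + Δ (suc n) (suc n)
      ≈⟨ +-cong (*-congˡ t (C-stable (ℕ.n≤1+n n))) (Δ-nondivisible (suc n) (suc n) m∤1+n) ⟩
    t * p m n + 0ₚ
      ≈⟨ +-identityʳ (t * p m n) ⟩
    t * p m n
      ∎

  p-multiple : ∀ {n j} → suc n ≡ m ℕ.* j → p m (suc n) ≈ t * p m n + p m j
  p-multiple {n} {j} 1+n≡mj = begin-equality
    C m (suc n) (suc n)                      ≈⟨ C-suc (suc n) n ⟩
    t * C m (suc n) n + Δ (suc n) (suc n)    ≡⟨ cong (λ k → t * C m (suc n) n + Δ (suc n) k) 1+n≡mj ⟩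
    t * C m (suc n) n + Δ (suc n) (m ℕ.* j)  ≈⟨ +-cong (*-congˡ t (C-stable (ℕ.n≤1+n n))) (Δ-multiple (suc n) j) ⟩
    t * p m n + C m n j                      ≈⟨ +-congˡ (t * p m n) (C-stable (1+n≡m*j⇒j≤n j 1+n≡mj)) ⟩
    t * p m n + p m j                        ∎

  t^m≈t*t^[m∸1] : t^ m ≈ t * t^ (m ∸ 1)
  t^m≈t*t^[m∸1] = ≈-trans (≈-reflexive (cong t^ (sym (ℕ.suc-pred m)))) (t^-suc (m ∸ 1))

  p-digit : ∀ {k r} → r < m → p m (m ℕ.* k ℕ.+ r) ≈ t^ r * p m (m ℕ.* k)
  p-digit {k} {zero}  _     = ≈-trans (≈-reflexive (cong (p m) (ℕ.+-identityʳ (m ℕ.* k)))) (≈-sym (*-identityˡ _))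
  p-digit {k} {suc r} 1+r<m = begin-equality
    p m (m ℕ.* k ℕ.+ suc r)     ≡⟨ cong (p m) (ℕ.+-suc (m ℕ.* k) r) ⟩
    p m (suc (m ℕ.* k ℕ.+ r))   ≈⟨ p-nondivisible m∤ ⟩
    t * p m (m ℕ.* k ℕ.+ r)     ≈⟨ *-congˡ t (p-digit (ℕ.<-trans (ℕ.n<1+n r) 1+r<m)) ⟩
    t * (t^ r * p m (m ℕ.* k))  ≈⟨ *-assoc t (t^ r) (p m (m ℕ.* k)) ⟨
    t * t^ r * p m (m ℕ.* k)    ≈⟨ *-congʳ (p m (m ℕ.* k)) (t^-suc r) ⟨
    t^ (suc r) * p m (m ℕ.* k)  ∎
    where
    m∤ : ¬ m ∣ suc (m ℕ.* k ℕ.+ r)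
    m∤ m∣ = ℕ.<⇒≱ 1+r<m (∣⇒≤ (∣m+n∣m⇒∣n (subst (m ∣_) (sym (ℕ.+-suc (m ℕ.* k) r)) m∣) (m∣m*n k)))

  p-m*suc : ∀ j → p m (m ℕ.* suc j) ≈ t^ m * p m (m ℕ.* j) + p m (suc j)
  p-m*suc j = begin-equality
    p m (m ℕ.* suc j)                               ≡⟨ cong (p m) (m*suc≡suc[m*+m∸1] j) ⟩
    p m (suc n)                                     ≈⟨ p-multiple (sym (m*suc≡suc[m*+m∸1] j)) ⟩
    t * p m n + p m (suc j)                         ≈⟨ +-congʳ (p m (suc j)) (*-congˡ t (p-digit m∸1<m)) ⟩
    t * (t^ (m ∸ 1) * p m (m ℕ.* j)) + p m (suc j)  ≈⟨ +-congʳ (p m (suc j)) (*-assoc t (t^ (m ∸ 1)) _) ⟨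
    t * t^ (m ∸ 1) * p m (m ℕ.* j) + p m (suc j)    ≈⟨ +-congʳ (p m (suc j)) (*-congʳ (p m (m ℕ.* j)) t^m≈t*t^[m∸1]) ⟨
    t^ m * p m (m ℕ.* j) + p m (suc j)              ∎
    where n = m ℕ.* j ℕ.+ (m ∸ 1)

  f-one : f m 1 ≈ 1ₚ
  f-one = ≈-reflexive (cong t^ (ℕ.*-zeroʳ (m ∸ 1)))

  f-suc : ∀ k → f m (suc k) ≈ 1ₚ + t^ (m ∸ 1) * f m k
  f-suc zero    = ≈-trans f-one (≈-sym (≈-trans (+-congˡ 1ₚ (zeroʳ (t^ (m ∸ 1)))) (+-identityʳ 1ₚ)))
  f-suc (suc k) = begin-equality
    f m (suc k) + t^ ((m ∸ 1) ℕ.* suc k)        ≈⟨ +-cong (f-suc k) t^[[m∸1][1+k]] ⟩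
    1ₚ + u * f m k + u * t^ ((m ∸ 1) ℕ.* k)     ≈⟨ regroup 1ₚ u (f m k) _ ⟩
    1ₚ + u * (f m k + t^ ((m ∸ 1) ℕ.* k))       ∎
    where
    u = t^ (m ∸ 1)
    t^[[m∸1][1+k]] : t^ ((m ∸ 1) ℕ.* suc k) ≈ u * t^ ((m ∸ 1) ℕ.* k)
    t^[[m∸1][1+k]] = ≈-trans (≈-reflexive (cong t^ (ℕ.*-suc (m ∸ 1) k))) (t^-+ (m ∸ 1) _)
    regroup : ∀ o u a b → o + u * a + u * b ≈ o + u * (a + b)
    regroup = solve-∀ ℤ[t]-ring

  h : ℕ → Poly
  h r = t^ r * f m (suc r)

  h-zero : h 0 ≈ 1ₚ
  h-zero = ≈-trans (*-identityˡ (f m 1)) f-one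

  h-suc : ∀ r → t^ m * h r + t^ (suc r) ≈ h (suc r)
  h-suc r = begin-equality
    t^ m * (t^ r * f m (suc r)) + t^ (suc r)    ≈⟨ +-cong (*-congʳ (h r) t^m≈t*t^[m∸1]) (t^-suc r) ⟩
    t * u * (t^ r * f m (suc r)) + t * t^ r     ≈⟨ regroup t u (t^ r) (f m (suc r)) ⟩
    t * t^ r * (1ₚ + u * f m (suc r))           ≈⟨ *-cong (≈-sym (t^-suc r)) (≈-sym (f-suc (suc r))) ⟩
    t^ (suc r) * f m (suc (suc r))              ∎
    where
    u = t^ (m ∸ 1)
    regroup : ∀ t u a b → t * u * (a * b) + t * a ≈ t * a * (1ₚ + u * b)
    regroup = solve-∀ ℤ[t]-ring

  t^m*h[m∸1]≈D : t^ m * h (m ∸ 1) ≈ D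
  t^m*h[m∸1]≈D = begin-equality
    t^ m * (t^ (m ∸ 1) * f m (suc (m ∸ 1)))  ≈⟨ *-assoc (t^ m) (t^ (m ∸ 1)) _ ⟨
    t^ m * t^ (m ∸ 1) * f m (suc (m ∸ 1))    ≈⟨ *-congʳ (f m (suc (m ∸ 1))) (t^-+ m (m ∸ 1)) ⟨
    t^ (m ℕ.+ (m ∸ 1)) * f m (suc (m ∸ 1))   ≡⟨ cong₂ (λ a b → t^ a * f m b) m+[m∸1]≡2m∸1 (ℕ.suc-pred m) ⟩
    t^ (2 ℕ.* m ∸ 1) * f m m                 ∎
    where
    m+[m∸1]≡2m∸1 : m ℕ.+ (m ∸ 1) ≡ 2 ℕ.* m ∸ 1
    m+[m∸1]≡2m∸1 = trans (sym (ℕ.+-∸-assoc m 0<m)) (cong (λ x → m ℕ.+ x ∸ 1) (sym (ℕ.+-identityʳ m)))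

  p-m*m≡ : ∀ k → p m (m ℕ.* (m ℕ.* k)) ≡ p m (m ℕ.* k) [mod D ]
  p-digit≡ : ∀ k {r} → r < m → p m (m ℕ.* (m ℕ.* k ℕ.+ r)) ≡ h r * p m (m ℕ.* k) [mod D ]

  p-m*m≡ zero    = ≈⇒≡[mod] (≈-reflexive (cong (λ x → p m (m ℕ.* x)) (ℕ.*-zeroʳ m)))
  p-m*m≡ (suc k) = begin
    p m (m ℕ.* (m ℕ.* suc k))
      ≡⟨ cong (λ x → p m (m ℕ.* x)) (m*suc≡suc[m*+m∸1] k) ⟩
    p m (m ℕ.* suc j)
      ≈⟨ p-m*suc j ⟩
    t^ m * p m (m ℕ.* j) + p m (suc j)
      ≲⟨ +-congʳ[mod] (p m (suc j)) (*-congˡ[mod] (t^ m) (p-digit≡ k m∸1<m)) ⟩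
    t^ m * (h (m ∸ 1) * p m (m ℕ.* k)) + p m (suc j)
      ≈⟨ +-congʳ (p m (suc j)) (*-assoc (t^ m) (h (m ∸ 1)) _) ⟨
    t^ m * h (m ∸ 1) * p m (m ℕ.* k) + p m (suc j)
      ≈⟨ +-congʳ (p m (suc j)) (*-congʳ (p m (m ℕ.* k)) t^m*h[m∸1]≈D) ⟩
    D * p m (m ℕ.* k) + p m (suc j)
      ≈⟨ +-congʳ (p m (suc j)) (*-comm D (p m (m ℕ.* k))) ⟩
    p m (m ℕ.* k) * D + p m (suc j)
      ≲⟨ multiple+x≡x (p m (m ℕ.* k)) (p m (suc j)) ⟩
    p m (suc j)
      ≡⟨ cong (p m) (m*suc≡suc[m*+m∸1] k) ⟨
    p m (m ℕ.* suc k)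
      ∎
    where j = m ℕ.* k ℕ.+ (m ∸ 1)

  p-digit≡ k {zero} _ = begin
    p m (m ℕ.* (m ℕ.* k ℕ.+ 0))  ≡⟨ cong (λ x → p m (m ℕ.* x)) (ℕ.+-identityʳ (m ℕ.* k)) ⟩
    p m (m ℕ.* (m ℕ.* k))        ≲⟨ p-m*m≡ k ⟩
    p m (m ℕ.* k)                ≈⟨ *-identityˡ (p m (m ℕ.* k)) ⟨
    1ₚ * p m (m ℕ.* k)           ≈⟨ *-congʳ (p m (m ℕ.* k)) h-zero ⟨
    h 0 * p m (m ℕ.* k)          ∎
  p-digit≡ k {suc r} 1+r<m = begin
    p m (m ℕ.* (m ℕ.* k ℕ.+ suc r))
      ≡⟨ cong (λ x → p m (m ℕ.* x)) (ℕ.+-suc (m ℕ.* k) r) ⟩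
    p m (m ℕ.* suc (m ℕ.* k ℕ.+ r))
      ≈⟨ p-m*suc (m ℕ.* k ℕ.+ r) ⟩
    t^ m * p m (m ℕ.* (m ℕ.* k ℕ.+ r)) + p m (suc (m ℕ.* k ℕ.+ r))
      ≈⟨ +-congˡ (t^ m * p m (m ℕ.* (m ℕ.* k ℕ.+ r))) digit ⟩
    t^ m * p m (m ℕ.* (m ℕ.* k ℕ.+ r)) + t^ (suc r) * p m (m ℕ.* k)
      ≲⟨ +-congʳ[mod] (t^ (suc r) * p m (m ℕ.* k)) (*-congˡ[mod] (t^ m) (p-digit≡ k r<m)) ⟩
    t^ m * (h r * p m (m ℕ.* k)) + t^ (suc r) * p m (m ℕ.* k)
      ≈⟨ factor (t^ m) (h r) (t^ (suc r)) (p m (m ℕ.* k)) ⟩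
    (t^ m * h r + t^ (suc r)) * p m (m ℕ.* k)
      ≈⟨ *-congʳ (p m (m ℕ.* k)) (h-suc r) ⟩
    h (suc r) * p m (m ℕ.* k)
      ∎
    where
    r<m : r < m
    r<m = ℕ.<-trans (ℕ.n<1+n r) 1+r<m
    digit : p m (suc (m ℕ.* k ℕ.+ r)) ≈ t^ (suc r) * p m (m ℕ.* k)
    digit = ≈-trans (≈-reflexive (cong (p m) (sym (ℕ.+-suc (m ℕ.* k) r)))) (p-digit 1+r<m)
    factor : ∀ a b c x → a * (b * x) + c * x ≈ (a * b + c) * x
    factor = solve-∀ ℤ[t]-ring

  p-digits≡ : ∀ {ds} → All (_< m) ds → p m (m ℕ.* digitsValue m ds) ≡ Π-digits ds h [mod D ]
  p-digits≡ []                         = ≈⇒≡[mod] (≈-reflexive (cong (p m) (ℕ.*-zeroʳ m)))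
  p-digits≡ {d ∷ ds} (d<m ∷ ds<m) = begin
    p m (m ℕ.* (d ℕ.+ m ℕ.* v))  ≡⟨ cong (λ x → p m (m ℕ.* x)) (ℕ.+-comm d (m ℕ.* v)) ⟩
    p m (m ℕ.* (m ℕ.* v ℕ.+ d))  ≲⟨ p-digit≡ v d<m ⟩
    h d * p m (m ℕ.* v)          ≲⟨ *-congˡ[mod] (h d) (p-digits≡ ds<m) ⟩
    h d * Π-digits ds h          ≈⟨ Π-digits-∷ d ds h ⟨
    Π-digits (d ∷ ds) h          ∎
    where v = digitsValue m ds

open import Data.Nat using (_+_; _*_)
open Polynomial using (≡[mod]⇒≡[modₚ]; *-congˡ[mod]; Π-digits; module ≡[mod]-Reasoning)

corollary5p4 : (m : ℕ) → 2 ≤ m → (n n₀ : ℕ) (ns : List ℕ) →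
    All (_< m) (n₀ ∷ ns) → TopNonzero ns → n ≡ digitsValue m (n₀ ∷ ns) →
    p m n ≡ (t^ n₀ *ₚ Π₁ₚ (length ns) (λ j → t^ (nth ns (j ∸ 1)) *ₚ f m (suc (nth ns (j ∸ 1)))))
    [modₚ (t^ (2 * m ∸ 1) *ₚ f m m) ]
corollary5p4 m 2≤m n n₀ ns (n₀<m ∷ ns<m) _ refl = ≡[mod]⇒≡[modₚ] (begin
  p m (n₀ + m * v)            ≡⟨ cong (p m) (ℕ.+-comm n₀ (m * v)) ⟩
  p m (m * v + n₀)            ≈⟨ p-digit n₀<m ⟩
  t^ n₀ *ₚ p m (m * v)        ≲⟨ *-congˡ[mod] (t^ n₀) (p-digits≡ ns<m) ⟩
  t^ n₀ *ₚ Π-digits ns h      ∎)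
  where
  open Digits m 2≤m using (p-digit; p-digits≡; h; D)
  open ≡[mod]-Reasoning D
  v = digitsValue m ns
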